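{- Let $S$ be a signature and $F_1,F_2$ two leaning $S$-forests of the same size $n$. If $F_1\preceq F_2$ and $I$ is an interval of $[n]$, then $F_1|_I\preceq F_2|_I$.
   Context: A signature is a set $S$ with arity map $|\cdot|:S\to\mathbb N$. An $S$-term is the leaf $\ell$ or $s\,t_1\cdots t_{|s|}$ with $s\in S$ and $S$-terms $t_i$. Internal nodes are numbered in preorder (root, then subterms left to right); $\mathrm{dc}(t)$ is the decoration word; the parent edge of node $i$ is $(\mathrm{pa}(i),\mathrm{lp}(i),i)$ with $i$ the $\mathrm{lp}(i)$-th child (leaves counted) of $\mathrm{pa}(i)$, and $\mathrm{pa}(1)=1,\mathrm{lp}(1)=0$; $\mathrm{cnc}(t)(i)=\mathrm{pa}(i)+1-2^{\mathrm{lp}(i)-a}$ with $a$ the arity of the decoration of $\mathrm{pa}(i)$; $t_1\preceq t_2$ iff $\mathrm{dc}(t_1)=\mathrm{dc}(t_2)$ and $\mathrm{cnc}(t_1)\le\mathrm{cnc}(t_2)$ componentwise. $S_{\mathbb N}=S\sqcup\mathbb N$ with $n\in\mathbb N$ of arity $n$. An $S$-forest is an $S_{\mathbb N}$-term $n\,t_1\cdots t_n$ with $t_i$ $S$-terms; balanced if of degree $n+1$ (size $n$); leaning if balanced and the root's non-leaf children precede its leaf children. Restriction: for a leaning forest $F$ of size $n$ and $I\subseteq[n]$, $F|_I$ is the leaning forest obtained by keeping only the internal nodes in $\{1\}\cup\{i+1:i\in I\}$: each kept non-root node whose parent is kept keeps its parent edge, each deleted non-root node's position becomes a leaf, the kept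 non-root nodes all of whose proper ancestors other than $1$ are deleted become, in preorder order, the first children of the root, and the root is decorated by $|I|$ and completed by leaves to $|I|$ children. -}

module Defs where

open import Data.Nat as ℕ using (ℕ; zero; suc; _∸_; _<?_)
open import Data.Bool using (Bool; true; false; if_then_else_)
open import Data.Sum using (_⊎_; inj₁; inj₂; [_,_])
open import Data.Product using (_×_; _,_; Σ)
open import Data.List as List using (List; []; _∷_; _++_; length)
open import Data.Vec as Vec using (Vec; []; _∷_; lookup)
open import Data.Fin as Fin using (Fin; fromℕ<)
open import Data.Fin.Subset using (Subset; _∈_; inside; outside; ∣_∣)
open import Data.Rational as ℚ using (ℚ; ½; 1ℚ)
open import Data.Integer using (+_)
open import Data.List.Relation.Binary.Pointwise using (Pointwise)
open import Relation.Nullary using (yes; no)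
open import Relation.Binary.PropositionalEquality using (_≡_)
open import Function using (id)

data Term (S : Set) (ar : S → ℕ) : Set where
  leaf : Term S ar
  node : (s : S) → Vec (Term S ar) (ar s) → Term S ar

module _ {S : Set} {ar : S → ℕ} where

  mutual
    degree : Term S ar → ℕ
    degree leaf        = 0
    degree (node s ts) = suc (degreeVec ts)

    degreeVec : ∀ {k} → Vec (Term S ar) k → ℕ
    degreeVec []       = 0
    degreeVec (t ∷ ts) = degree t ℕ.+ degreeVec ts

  halfPow : ℕ → ℚ
  halfPow zero    = 1ℚ
  halfPow (suc k) = ½ ℚ.* halfPow k

  -- Data attached to an internal node i (in preorder):
  -- its decoration, pa(i), lp(i), and the arity of the decoration of pa(i).
  record NodeInfo : Set where
    constructor info
    field
      deco  : S
      pa    : ℕ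
      lp    : ℕ
      paAr  : ℕ

  -- preorder traversal; `next` is the number the next internal node gets
  mutual
    infos : (next pa lp paAr : ℕ) → Term S ar → List NodeInfo
    infos next p l a leaf        = []
    infos next p l a (node s ts) = info s p l a ∷ infosVec (suc next) next (ar s) 1 ts

    -- children of node number p (arity a), starting at child position l
    infosVec : ∀ {k} (next p a l : ℕ) → Vec (Term S ar) k → List NodeInfo
    infosVec next p a l []       = []
    infosVec next p a l (t ∷ ts) =
      infos next p l a t ++ infosVec (next ℕ.+ degree t) p a (suc l) ts

  -- all internal nodes, numbered from 1; pa(1) = 1, lp(1) = 0
  nodeInfos : Term S ar → List NodeInfo
  nodeInfos leaf        = []
  nodeInfos (node s ts) = infos 1 1 0 (ar s) (node s ts)

  dc : Term S ar → List S
  dc t = List.map NodeInfo.deco (nodeInfos t)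

  -- cnc(t)(i) = pa(i) + 1 - 2^(lp(i) - a)   (note lp(i) ≤ a always)
  cncEntry : NodeInfo → ℚ
  cncEntry (info s p l a) = ((+ suc p) ℚ./ 1) ℚ.- halfPow (a ∸ l)

  cnc : Term S ar → List ℚ
  cnc t = List.map cncEntry (nodeInfos t)

  _⪯_ : Term S ar → Term S ar → Set
  t₁ ⪯ t₂ = (dc t₁ ≡ dc t₂) × Pointwise ℚ._≤_ (cnc t₁) (cnc t₂)

module _ (S : Set) (ar : S → ℕ) where

  SN : Set
  SN = S ⊎ ℕ

  arN : SN → ℕ
  arN = [ ar , id ]

  -- An S-forest of size n is the S_ℕ-term  n t₁ ⋯ tₙ ; we store t₁ ⋯ tₙ.
  Forest : ℕ → Set
  Forest n = Vec (Term S ar) n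

module _ {S : Set} {ar : S → ℕ} where

  mutual
    embed : Term S ar → Term (SN S ar) (arN S ar)
    embed leaf        = leaf
    embed (node s ts) = node (inj₁ s) (embedVec ts)

    embedVec : ∀ {k} → Vec (Term S ar) k → Vec (Term (SN S ar) (arN S ar)) k
    embedVec []       = []
    embedVec (t ∷ ts) = embed t ∷ embedVec ts

  toTerm : ∀ {n} → Forest S ar n → Term (SN S ar) (arN S ar)
  toTerm {n} ts = node (inj₂ n) (embedVec ts)

  _⪯F_ : ∀ {m n} → Forest S ar m → Forest S ar n → Set
  F₁ ⪯F F₂ = toTerm F₁ ⪯ toTerm F₂

  Balanced : ∀ {n} → Forest S ar n → Set
  Balanced {n} F = degree (toTerm F) ≡ suc n

  IsLeaf : Term S ar → Set
  IsLeaf t = t ≡ leaf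

  Leaning : ∀ {n} → Forest S ar n → Set
  Leaning {n} F = Balanced F ×
    (∀ (i j : Fin n) → i Fin.< j → IsLeaf (lookup F i) → IsLeaf (lookup F j))

  -- Non-root internal nodes of a forest of size n are numbered 2,…,n+1 in
  -- preorder; node i+1 (i ∈ [n]) is kept iff i ∈ I.  We index them from 0:
  -- the c-th (0-based) non-root internal node is node c+2, i.e. i = c+1,
  -- which is the element (fromℕ c) of Fin n.

  keepIdx : ∀ {n} → Subset n → ℕ → Bool
  keepIdx {n} I c with c <? n
  ... | yes c<n with lookup I (fromℕ< c<n)
  ...   | inside  = true
  ...   | outside = false
  keepIdx {n} I c | no _ = false

  -- prune keep pk c t : t's first internal node has 0-based index c; pk says
  -- whether the parent of t's root is kept (and not the forest root).
  -- Returns (what occupies t's position in its parent, the list of kept nodes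
  -- whose parent is deleted, as pruned trees in preorder).
  mutual
    prune : (ℕ → Bool) → Bool → ℕ → Term S ar → Term S ar × List (Term S ar)
    prune keep pk c leaf = leaf , []
    prune keep pk c (node s ts) with keep c | pruneVec keep (keep c) (suc c) ts
    ... | true  | slots , em = if pk then (node s slots , em) else (leaf , node s slots ∷ em)
    ... | false | slots , em = leaf , em

    pruneVec : ∀ {k} → (ℕ → Bool) → Bool → ℕ → Vec (Term S ar) k →
               Vec (Term S ar) k × List (Term S ar)
    pruneVec keep pk c [] = [] , []
    pruneVec keep pk c (t ∷ ts) with prune keep pk c t | pruneVec keep pk (c ℕ.+ degree t) ts
    ... | t' , em₁ | ts' , em₂ = t' ∷ ts' , em₁ ++ em₂

  -- root children of the restriction: each top-level tree is processed with
  -- "parent not kept" so that its surviving top nodes become root children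
  rootChildren : ∀ {k} → (ℕ → Bool) → ℕ → Vec (Term S ar) k → List (Term S ar)
  rootChildren keep c []       = []
  rootChildren keep c (t ∷ ts) =
    Data.Product.proj₂ (prune keep false c t) List.++ rootChildren keep (c ℕ.+ degree t) ts
    where import Data.Product

  padTo : (k : ℕ) → List (Term S ar) → Vec (Term S ar) k
  padTo zero    _        = []
  padTo (suc k) []       = leaf ∷ padTo k []
  padTo (suc k) (t ∷ ts) = t ∷ padTo k ts

  restrictF : ∀ {n} → Forest S ar n → (I : Subset n) → Forest S ar ∣ I ∣
  restrictF F I = padTo ∣ I ∣ (rootChildren (keepIdx I) 0 F)


IsInterval : ∀ {n} → Subset n → Set
IsInterval {n} I = ∀ {i j k : Fin n} → i Fin.≤ j → j Fin.≤ k → i ∈ I → k ∈ I → j ∈ I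

-- Restriction acts on the preorder list of node records (decoration, parent, child position, parent
-- arity) of the non-root nodes as a left-to-right transducer: a deleted node vanishes, a kept node with
-- a kept parent keeps its record with the parent renumbered, and a kept node with a deleted parent
-- becomes the next child of the root.  For an interval I this is exactly F|_I, because in preorder a
-- deleted node below a kept one is followed only by deleted nodes.
-- The cnc entry p + 1 − 2^(lp − a) determines the parent p, so F₁ ⪯ F₂ puts each parent in F₁ weakly
-- before the corresponding parent in F₂, and both before the node itself.  As I is an interval, a
-- parent surviving in F₁ then survives in F₂; renumbering is monotone, and F₁ has always produced at
-- least as many root children as F₂, which orders the root-child entries 2 − 2^(r − |I|) as well.
module Submission where

open import Data.Bool using (Bool; true; false; if_then_else_)
open import Data.Fin using (fromℕ<)
open import Data.Fin.Properties using (toℕ-fromℕ<)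
open import Data.Fin.Subset using (Subset; ∣_∣; _∈_)
import Data.Integer as ℤ
import Data.Integer.Properties as ℤ
open import Data.List as List using (List; []; _∷_; _++_; length)
open import Data.List.Properties using (length-++; ++-assoc; ++-identityʳ; ∷-injective; ∷-injectiveʳ; map-++)
open import Data.List.Relation.Binary.Pointwise using (Pointwise; []; _∷_)
open import Data.Nat
open import Data.Nat.Properties
import Data.Nat.Coprimality as Coprime
open import Data.Product using (_×_; _,_; proj₁; proj₂)
open import Data.Rational as ℚ using (ℚ; 0ℚ; 1ℚ; ½)
import Data.Rational.Properties as ℚ
open import Data.Sum using (inj₁; inj₂)
open import Data.Unit using (⊤; tt)
open import Data.Vec using (Vec; []; _∷_; lookup)
open import Data.Vec.Properties using ([]=⇒lookup; lookup⇒[]=)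
open import Function using (id)
open import Relation.Binary.PropositionalEquality
open import Relation.Nullary using (yes; no; contradiction)
open import Relation.Nullary.Decidable using (toWitness)
open import Defs

fromℕ : ℕ → ℚ
fromℕ n = ℤ.+ n ℚ./ 1

fromℕ≡mkℚ : ∀ n → fromℕ n ≡ ℚ.mkℚ (ℤ.+ n) 0 (Coprime.sym (Coprime.1-coprimeTo n))
fromℕ≡mkℚ n = ℚ.normalize-coprime (Coprime.sym (Coprime.1-coprimeTo n))

fromℕ-mono-≤ : ∀ {m n} → m ≤ n → fromℕ m ℚ.≤ fromℕ n
fromℕ-mono-≤ {m} {n} m≤n rewrite fromℕ≡mkℚ m | fromℕ≡mkℚ n =
  ℚ.*≤* (subst₂ ℤ._≤_ (sym (ℤ.*-identityʳ (ℤ.+ m))) (sym (ℤ.*-identityʳ (ℤ.+ n))) (ℤ.+≤+ m≤n))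

fromℕ-suc : ∀ n → fromℕ n ℚ.+ 1ℚ ≡ fromℕ (suc n)
fromℕ-suc n = trans (cong₂ ℚ._+_ (fromℕ≡mkℚ n) (fromℕ≡mkℚ 1))
  (cong (ℚ._/ 1) (trans (cong (ℤ._+ ℤ.+ 1) (trans (ℤ.+◃n≡+n (n * 1)) (cong ℤ.+_ (*-identityʳ n))))
                        (cong ℤ.+_ (+-comm n 1))))

x-h≤x : ∀ x {h} → 0ℚ ℚ.≤ h → x ℚ.- h ℚ.≤ x
x-h≤x x 0≤h = ℚ.≤-trans (ℚ.+-monoʳ-≤ x (ℚ.neg-antimono-≤ 0≤h)) (ℚ.≤-reflexive (ℚ.+-identityʳ x))

x-h<x : ∀ x {h} → 0ℚ ℚ.< h → x ℚ.- h ℚ.< x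
x-h<x x 0<h = ℚ.<-≤-trans (ℚ.+-monoʳ-< x (ℚ.neg-antimono-< 0<h)) (ℚ.≤-reflexive (ℚ.+-identityʳ x))

minus-antimonoʳ-≤ : ∀ x {h₁ h₂} → h₁ ℚ.≤ h₂ → x ℚ.- h₂ ℚ.≤ x ℚ.- h₁
minus-antimonoʳ-≤ x h₁≤h₂ = ℚ.+-monoʳ-≤ x (ℚ.neg-antimono-≤ h₁≤h₂)

minus-translate : ∀ x y {h₁ h₂} → x ℚ.- h₁ ℚ.≤ x ℚ.- h₂ → y ℚ.- h₁ ℚ.≤ y ℚ.- h₂
minus-translate x y {h₁} {h₂} le = subst₂ ℚ._≤_ (y-x+[x-h]≡y-h h₁) (y-x+[x-h]≡y-h h₂) (ℚ.+-monoʳ-≤ (y ℚ.- x) le)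
  where
  open ≡-Reasoning
  y-x+[x-h]≡y-h : ∀ h → (y ℚ.- x) ℚ.+ (x ℚ.- h) ≡ y ℚ.- h
  y-x+[x-h]≡y-h h = begin
    (y ℚ.- x) ℚ.+ (x ℚ.- h)     ≡⟨ ℚ.+-assoc (y ℚ.- x) x (ℚ.- h) ⟨
    ((y ℚ.- x) ℚ.+ x) ℚ.- h     ≡⟨ cong (ℚ._- h) (ℚ.+-assoc y (ℚ.- x) x) ⟩
    (y ℚ.+ (ℚ.- x ℚ.+ x)) ℚ.- h ≡⟨ cong (λ z → (y ℚ.+ z) ℚ.- h) (ℚ.+-inverseˡ x) ⟩
    (y ℚ.+ 0ℚ) ℚ.- h            ≡⟨ cong (ℚ._- h) (ℚ.+-identityʳ y) ⟩
    y ℚ.- h                     ∎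

fromℕ-pred : ∀ n → fromℕ n ≡ fromℕ (suc n) ℚ.- 1ℚ
fromℕ-pred n = begin
  fromℕ n                        ≡⟨ ℚ.+-identityʳ (fromℕ n) ⟨
  fromℕ n ℚ.+ 0ℚ                 ≡⟨ cong (fromℕ n ℚ.+_) (ℚ.+-inverseʳ 1ℚ) ⟨
  fromℕ n ℚ.+ (1ℚ ℚ.- 1ℚ)        ≡⟨ ℚ.+-assoc (fromℕ n) 1ℚ (ℚ.- 1ℚ) ⟨
  (fromℕ n ℚ.+ 1ℚ) ℚ.- 1ℚ        ≡⟨ cong (ℚ._- 1ℚ) (fromℕ-suc n) ⟩
  fromℕ (suc n) ℚ.- 1ℚ           ∎
  where open ≡-Reasoning

module HalfPow {S : Set} {ar : S → ℕ} where

  private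
    H : ℕ → ℚ
    H = halfPow {S} {ar}

  halfPow-positive : ∀ k → ℚ.Positive (H k)
  halfPow-positive zero    = _
  halfPow-positive (suc k) = ℚ.pos*pos⇒pos ½ (H k) {{halfPow-positive k}}

  halfPow>0 : ∀ k → 0ℚ ℚ.< H k
  halfPow>0 k = ℚ.positive⁻¹ (H k) {{halfPow-positive k}}

  halfPow≥0 : ∀ k → 0ℚ ℚ.≤ H k
  halfPow≥0 k = ℚ.<⇒≤ (halfPow>0 k)

  halfPow-suc≤ : ∀ k → H (suc k) ℚ.≤ H k
  halfPow-suc≤ k = ℚ.≤-trans
    (ℚ.*-monoʳ-≤-nonNeg (H k) {{ℚ.pos⇒nonNeg (H k) {{halfPow-positive k}}}} (toWitness {a? = ½ ℚ.≤? 1ℚ} tt))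
    (ℚ.≤-reflexive (ℚ.*-identityˡ (H k)))

  halfPow-antimono : ∀ {j k} → j ≤ k → H k ℚ.≤ H j
  halfPow-antimono {zero}  {zero}  z≤n       = ℚ.≤-refl
  halfPow-antimono {zero}  {suc k} z≤n       = ℚ.≤-trans (halfPow-suc≤ k) (halfPow-antimono {zero} {k} z≤n)
  halfPow-antimono {suc j} {suc k} (s≤s j≤k) = ℚ.*-monoˡ-≤-nonNeg ½ (halfPow-antimono j≤k)

  halfPow≤1 : ∀ k → H k ℚ.≤ 1ℚ
  halfPow≤1 k = halfPow-antimono {0} {k} z≤n

-- cncEntry (info s p l a) is p + 1 − h with h = 2^(l − a) ∈ (0, 1], so the entry determines p.
entry-≤⇒parent-≤ : ∀ {p₁ p₂ h₁ h₂} → h₁ ℚ.≤ 1ℚ → 0ℚ ℚ.< h₂ →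
                   fromℕ (suc p₁) ℚ.- h₁ ℚ.≤ fromℕ (suc p₂) ℚ.- h₂ → p₁ ≤ p₂
entry-≤⇒parent-≤ {p₁} {p₂} {h₁} {h₂} h₁≤1 0<h₂ e₁≤e₂ = ≮⇒≥ λ p₂<p₁ → ℚ.<-irrefl refl (begin-strict
  fromℕ (suc p₂) ℚ.- h₂ <⟨ x-h<x (fromℕ (suc p₂)) 0<h₂ ⟩
  fromℕ (suc p₂)        ≤⟨ fromℕ-mono-≤ p₂<p₁ ⟩
  fromℕ p₁              ≡⟨ fromℕ-pred p₁ ⟩
  fromℕ (suc p₁) ℚ.- 1ℚ ≤⟨ minus-antimonoʳ-≤ (fromℕ (suc p₁)) h₁≤1 ⟩
  fromℕ (suc p₁) ℚ.- h₁ ≤⟨ e₁≤e₂ ⟩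
  fromℕ (suc p₂) ℚ.- h₂ ∎)
  where open ℚ.≤-Reasoning

parent-<⇒entry-≤ : ∀ {p₁ p₂ h₁ h₂} → 0ℚ ℚ.≤ h₁ → h₂ ℚ.≤ 1ℚ → p₁ < p₂ →
                   fromℕ (suc p₁) ℚ.- h₁ ℚ.≤ fromℕ (suc p₂) ℚ.- h₂
parent-<⇒entry-≤ {p₁} {p₂} {h₁} {h₂} 0≤h₁ h₂≤1 p₁<p₂ = begin
  fromℕ (suc p₁) ℚ.- h₁ ≤⟨ x-h≤x (fromℕ (suc p₁)) 0≤h₁ ⟩
  fromℕ (suc p₁)        ≤⟨ fromℕ-mono-≤ p₁<p₂ ⟩
  fromℕ p₂              ≡⟨ fromℕ-pred p₂ ⟩
  fromℕ (suc p₂) ℚ.- 1ℚ ≤⟨ minus-antimonoʳ-≤ (fromℕ (suc p₂)) h₂≤1 ⟩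
  fromℕ (suc p₂) ℚ.- h₂ ∎
  where open ℚ.≤-Reasoning

module _ {S : Set} {ar : S → ℕ} where

  private
    Info = NodeInfo {S} {ar}
    Tm   = Term S ar

  infix 4 _≼_
  record _≼_ (X Y : List Info) : Set where
    constructor mk≼
    field
      deco≡ : List.map NodeInfo.deco X ≡ List.map NodeInfo.deco Y
      cnc≤  : Pointwise ℚ._≤_ (List.map cncEntry X) (List.map cncEntry Y)

  -- The non-root nodes of  n t₁ ⋯ tₙ : numbered from 2, the tᵢ hanging from the root 1 of arity n.
  forestInfos : ∀ {n} → Forest S ar n → List Info
  forestInfos {n} F = infosVec 2 1 n 1 F

  infosL : (next p a l : ℕ) → List Tm → List Info
  infosL next p a l []       = []
  infosL next p a l (t ∷ ts) = infos next p l a t ++ infosL (next + degree t) p a (suc l) ts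

  degreeL : List Tm → ℕ
  degreeL []       = 0
  degreeL (t ∷ ts) = degree t + degreeL ts

  mutual
    length-infos : ∀ next p l a (t : Tm) → length (infos next p l a t) ≡ degree t
    length-infos next p l a leaf        = refl
    length-infos next p l a (node s ts) = cong suc (length-infosVec (suc next) next (ar s) 1 ts)

    length-infosVec : ∀ {k} next p a l (ts : Vec Tm k) → length (infosVec next p a l ts) ≡ degreeVec ts
    length-infosVec next p a l []       = refl
    length-infosVec next p a l (t ∷ ts) = trans (length-++ (infos next p l a t))
      (cong₂ _+_ (length-infos next p l a t) (length-infosVec (next + degree t) p a (suc l) ts))

  length-infosL : ∀ next p a l (ts : List Tm) → length (infosL next p a l ts) ≡ degreeL ts
  length-infosL next p a l []       = refl
  length-infosL next p a l (t ∷ ts) = trans (length-++ (infos next p l a t))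
    (cong₂ _+_ (length-infos next p l a t) (length-infosL (next + degree t) p a (suc l) ts))

  infosL-++ : ∀ next p a l (ts us : List Tm) →
              infosL next p a l (ts ++ us) ≡ infosL next p a l ts ++ infosL (next + degreeL ts) p a (length ts + l) us
  infosL-++ next p a l [] us rewrite +-identityʳ next = refl
  infosL-++ next p a l (t ∷ ts) us = begin
    infos next p l a t ++ infosL (next + degree t) p a (suc l) (ts ++ us)
      ≡⟨ cong (infos next p l a t ++_) (infosL-++ (next + degree t) p a (suc l) ts us) ⟩
    infos next p l a t ++ (infosL (next + degree t) p a (suc l) ts ++
                           infosL (next + degree t + degreeL ts) p a (length ts + suc l) us)
      ≡⟨ cong₂ (λ k j → infos next p l a t ++ (infosL (next + degree t) p a (suc l) ts ++ infosL k p a j us))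
               (+-assoc next (degree t) (degreeL ts)) (+-suc (length ts) l) ⟩
    infos next p l a t ++ (infosL (next + degree t) p a (suc l) ts ++
                           infosL (next + (degree t + degreeL ts)) p a (suc (length ts + l)) us)
      ≡⟨ ++-assoc (infos next p l a t) _ _ ⟨
    (infos next p l a t ++ infosL (next + degree t) p a (suc l) ts) ++
      infosL (next + (degree t + degreeL ts)) p a (suc (length ts + l)) us ∎
    where open ≡-Reasoning

  infosVec-padTo : ∀ next p a l k (ts : List Tm) → length ts ≤ k → infosVec next p a l (padTo k ts) ≡ infosL next p a l ts
  infosVec-padTo next p a l zero    []       _         = refl
  infosVec-padTo next p a l (suc k) []       _         = infosVec-padTo (next + 0) p a (suc l) k [] z≤n
  infosVec-padTo next p a l (suc k) (t ∷ ts) (s≤s len) =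
    cong (infos next p l a t ++_) (infosVec-padTo (next + degree t) p a (suc l) k ts len)

  ⪯⇒≼ : ∀ {t₁ t₂ : Tm} → t₁ ⪯ t₂ → nodeInfos t₁ ≼ nodeInfos t₂
  ⪯⇒≼ (ds , es) = mk≼ ds es

  ≼⇒⪯ : ∀ {t₁ t₂ : Tm} → nodeInfos t₁ ≼ nodeInfos t₂ → t₁ ⪯ t₂
  ≼⇒⪯ (mk≼ ds es) = ds , es

  ∷-≼⁻ : ∀ {x y : Info} {X Y} → x ∷ X ≼ y ∷ Y → X ≼ Y
  ∷-≼⁻ (mk≼ ds (_ ∷ es)) = mk≼ (∷-injectiveʳ ds) es

-- Non-root nodes are indexed from 0 in preorder, as in keepIdx: index j is preorder number j + 2.
module _ (keep : ℕ → Bool) where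

  keptBefore : ℕ → ℕ
  keptBefore zero    = zero
  keptBefore (suc c) = if keep c then suc (keptBefore c) else keptBefore c

  parentKept : ℕ → Bool
  parentKept (suc (suc j)) = keep j
  parentKept _             = false

  IsIntervalᵇ : Set
  IsIntervalᵇ = ∀ {i j k} → i ≤ j → j ≤ k → keep i ≡ true → keep k ≡ true → keep j ≡ true

  NoneKeptFrom : ℕ → Set
  NoneKeptFrom c = ∀ j → c ≤ j → keep j ≡ false

  keptBefore-kept : ∀ c → keep c ≡ true → keptBefore (suc c) ≡ suc (keptBefore c)
  keptBefore-kept c kc rewrite kc = refl

  keptBefore-deleted : ∀ c → keep c ≡ false → keptBefore (suc c) ≡ keptBefore c
  keptBefore-deleted c kc rewrite kc = refl

  keptBefore-mono : ∀ {i j} → i ≤ j → keptBefore i ≤ keptBefore j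
  keptBefore-mono {i} {j} i≤j with m≤n⇒∃[o]m+o≡n i≤j
  ... | o , refl = go i o
    where
    go : ∀ i o → keptBefore i ≤ keptBefore (i + o)
    go i zero    rewrite +-identityʳ i = ≤-refl
    go i (suc o) rewrite +-suc i o with keep (i + o)
    ... | true  = m≤n⇒m≤1+n (go i o)
    ... | false = go i o

  keptBefore-strict : ∀ {i j} → keep i ≡ true → i < j → keptBefore i < keptBefore j
  keptBefore-strict {i} ki i<j = ≤-trans (≤-reflexive (sym (keptBefore-kept i ki))) (keptBefore-mono i<j)

  parentKept⇒ : ∀ p → parentKept p ≡ true → 2 ≤ p × keep (p ∸ 2) ≡ true
  parentKept⇒ (suc (suc j)) kj = s≤s (s≤s z≤n) , kj

  parentKept-≥2 : ∀ p → 2 ≤ p → parentKept p ≡ keep (p ∸ 2)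
  parentKept-≥2 (suc (suc j)) _ = refl
  parentKept-≥2 (suc zero) (s≤s ())

  noneKeptFrom-suc : ∀ {c} → NoneKeptFrom c → NoneKeptFrom (suc c)
  noneKeptFrom-suc none j c<j = none j (≤-trans (n≤1+n _) c<j)

  noneKeptFrom-+ : ∀ {c} k → NoneKeptFrom c → NoneKeptFrom (c + k)
  noneKeptFrom-+ {c} k none j le = none j (≤-trans (m≤m+n c k) le)

  module _ {S : Set} {ar : S → ℕ} (m : ℕ) where

    private
      Info = NodeInfo {S} {ar}
      Tm   = Term S ar

    -- Restriction read off the node records, from index c on; r counts the root children produced so far.
    restrictInfos : ℕ → ℕ → List Info → List Info
    restrictInfos c r [] = []
    restrictInfos c r (info d p l a ∷ xs) with keep c | parentKept p
    ... | false | _     = restrictInfos (suc c) r xs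
    ... | true  | true  = info d (2 + keptBefore (p ∸ 2)) l a ∷ restrictInfos (suc c) r xs
    ... | true  | false = info d 1 (suc r) m ∷ restrictInfos (suc c) (suc r) xs

    rootsAfter : ℕ → ℕ → List Info → ℕ
    rootsAfter c r [] = r
    rootsAfter c r (info d p l a ∷ xs) with keep c | parentKept p
    ... | false | _     = rootsAfter (suc c) r xs
    ... | true  | true  = rootsAfter (suc c) r xs
    ... | true  | false = rootsAfter (suc c) (suc r) xs

    restrictInfos-++ : ∀ c r X Y → restrictInfos c r (X ++ Y) ≡ restrictInfos c r X ++ restrictInfos (c + length X) (rootsAfter c r X) Y
    restrictInfos-++ c r [] Y rewrite +-identityʳ c = refl
    restrictInfos-++ c r (info d p l a ∷ X) Y rewrite +-suc c (length X) with keep c | parentKept p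
    ... | false | _     = restrictInfos-++ (suc c) r X Y
    ... | true  | true  = cong (_ ∷_) (restrictInfos-++ (suc c) r X Y)
    ... | true  | false = cong (_ ∷_) (restrictInfos-++ (suc c) (suc r) X Y)

    rootsAfter-++ : ∀ c r X Y → rootsAfter c r (X ++ Y) ≡ rootsAfter (c + length X) (rootsAfter c r X) Y
    rootsAfter-++ c r [] Y rewrite +-identityʳ c = refl
    rootsAfter-++ c r (info d p l a ∷ X) Y rewrite +-suc c (length X) with keep c | parentKept p
    ... | false | _     = rootsAfter-++ (suc c) r X Y
    ... | true  | true  = rootsAfter-++ (suc c) r X Y
    ... | true  | false = rootsAfter-++ (suc c) (suc r) X Y

    length-restrictInfos : ∀ c r X → keptBefore c + length (restrictInfos c r X) ≡ keptBefore (c + length X)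
    length-restrictInfos c r [] rewrite +-identityʳ c | +-identityʳ (keptBefore c) = refl
    length-restrictInfos c r (info d p l a ∷ X) rewrite +-suc c (length X) with keep c in kc | parentKept p
    ... | false | _     = trans (cong (_+ length (restrictInfos (suc c) r X)) (sym (keptBefore-deleted c kc)))
                                (length-restrictInfos (suc c) r X)
    ... | true  | true  = trans (+-suc (keptBefore c) _)
                            (trans (cong (_+ length (restrictInfos (suc c) r X)) (sym (keptBefore-kept c kc)))
                                   (length-restrictInfos (suc c) r X))
    ... | true  | false = trans (+-suc (keptBefore c) _)
                            (trans (cong (_+ length (restrictInfos (suc c) (suc r) X)) (sym (keptBefore-kept c kc)))
                                   (length-restrictInfos (suc c) (suc r) X))

    rootsAfter≤ : ∀ c r X → rootsAfter c r X ≤ r + length (restrictInfos c r X)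
    rootsAfter≤ c r [] = ≤-reflexive (sym (+-identityʳ r))
    rootsAfter≤ c r (info d p l a ∷ X) with keep c | parentKept p
    ... | false | _     = rootsAfter≤ (suc c) r X
    ... | true  | true  = ≤-trans (rootsAfter≤ (suc c) r X) (+-monoʳ-≤ r (n≤1+n _))
    ... | true  | false = ≤-trans (rootsAfter≤ (suc c) (suc r) X) (≤-reflexive (sym (+-suc r _)))

    restrictInfos-noneKept : ∀ c r X → NoneKeptFrom c → restrictInfos c r X ≡ [] × rootsAfter c r X ≡ r
    restrictInfos-noneKept c r [] none = refl , refl
    restrictInfos-noneKept c r (info d p l a ∷ X) none with keep c in kc
    ... | true  = contradiction (trans (sym kc) (none c ≤-refl)) λ ()
    ... | false = restrictInfos-noneKept (suc c) r X (noneKeptFrom-suc none)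

    restrictInfos-++-segments : ∀ {c r r′ k} X Y {U V} → length X ≡ k → U ≡ restrictInfos c r X →
      rootsAfter c r X ≡ r′ → V ≡ restrictInfos (c + k) r′ Y → U ++ V ≡ restrictInfos c r (X ++ Y)
    restrictInfos-++-segments X Y refl refl refl refl = sym (restrictInfos-++ _ _ X Y)

    rootsAfter-++-segments : ∀ {c r r′ r″ k} X Y → length X ≡ k →
      rootsAfter c r X ≡ r′ → rootsAfter (c + k) r′ Y ≡ r″ → rootsAfter c r (X ++ Y) ≡ r″
    rootsAfter-++-segments X Y refl refl refl = rootsAfter-++ _ _ X Y

    keptBefore-segment : ∀ {c r k} X {U} → length X ≡ k → U ≡ restrictInfos c r X →
      keptBefore c + length U ≡ keptBefore (c + k)
    keptBefore-segment X refl refl = length-restrictInfos _ _ X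

module _ (keep : ℕ → Bool) {S : Set} {ar : S → ℕ} where

  private
    Tm = Term S ar

  mutual
    prune-noneKept : ∀ pk c (t : Tm) → NoneKeptFrom keep c → prune keep pk c t ≡ (leaf , [])
    prune-noneKept pk c leaf        none = refl
    prune-noneKept pk c (node s ts) none rewrite none c ≤-refl =
      cong (leaf ,_) (pruneVec-noneKept false (suc c) ts (noneKeptFrom-suc keep none))

    pruneVec-noneKept : ∀ {k} pk c (ts : Vec Tm k) → NoneKeptFrom keep c → proj₂ (pruneVec keep pk c ts) ≡ []
    pruneVec-noneKept pk c []       none = refl
    pruneVec-noneKept pk c (t ∷ ts) none =
      cong₂ _++_ (cong proj₂ (prune-noneKept pk c t none))
                 (pruneVec-noneKept pk (c + degree t) ts (noneKeptFrom-+ keep (degree t) none))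

  module _ (m : ℕ) (interval : IsIntervalᵇ keep) where

    noneKeptAfterDeleted : ∀ {j c} → keep j ≡ true → j ≤ c → keep c ≡ false → NoneKeptFrom keep c
    noneKeptAfterDeleted {j} {c} kj j≤c kc i c≤i with keep i in ki
    ... | false = refl
    ... | true  = contradiction (trans (sym (interval j≤c c≤i kj ki)) kc) λ ()

    -- Below a kept node, convexity means nothing is detached from the subtree.
    mutual
      prune-belowKept : ∀ c q l a r (t : Tm) → parentKept keep q ≡ true → q ≤ suc c →
        proj₂ (prune keep true c t) ≡ [] ×
        infos (2 + keptBefore keep c) (2 + keptBefore keep (q ∸ 2)) l a (proj₁ (prune keep true c t))
          ≡ restrictInfos keep m c r (infos (2 + c) q l a t) ×
        rootsAfter keep m c r (infos (2 + c) q l a t) ≡ r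
      prune-belowKept c q l a r leaf kq q≤1+c = refl , refl , refl
      prune-belowKept c q l a r (node s ts) kq q≤1+c with keep c in kc
      ... | false =
        let none = noneKeptAfterDeleted (proj₂ (parentKept⇒ keep q kq)) (≤-trans (∸-monoˡ-≤ 2 q≤1+c) (m∸n≤m c 1)) kc
            T≡[] , R≡r = restrictInfos-noneKept keep m (suc c) r (infosVec (3 + c) (2 + c) (ar s) 1 ts)
                           (noneKeptFrom-suc keep none)
        in pruneVec-noneKept false (suc c) ts (noneKeptFrom-suc keep none) , sym T≡[] , R≡r
      ... | true rewrite kq =
        let A , B , C = prune-belowKeptVec (suc c) (2 + c) (ar s) 1 r ts kc ≤-refl
        in A , cong (info s (2 + keptBefore keep (q ∸ 2)) l a ∷_)
                    (subst (λ k → infosVec (2 + k) (2 + keptBefore keep c) (ar s) 1 (proj₁ (pruneVec keep true (suc c) ts))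
                                  ≡ restrictInfos keep m (suc c) r (infosVec (3 + c) (2 + c) (ar s) 1 ts))
                           (keptBefore-kept keep c kc) B) ,
           C

      prune-belowKeptVec : ∀ {k} c q a l r (ts : Vec Tm k) → parentKept keep q ≡ true → q ≤ suc c →
        proj₂ (pruneVec keep true c ts) ≡ [] ×
        infosVec (2 + keptBefore keep c) (2 + keptBefore keep (q ∸ 2)) a l (proj₁ (pruneVec keep true c ts))
          ≡ restrictInfos keep m c r (infosVec (2 + c) q a l ts) ×
        rootsAfter keep m c r (infosVec (2 + c) q a l ts) ≡ r
      prune-belowKeptVec c q a l r []       kq q≤1+c = refl , refl , refl
      prune-belowKeptVec c q a l r (t ∷ ts) kq q≤1+c =
        let A₁ , B₁ , C₁ = prune-belowKept c q l a r t kq q≤1+c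
            A₂ , B₂ , C₂ = prune-belowKeptVec (c + degree t) q a (suc l) r ts kq (≤-trans q≤1+c (s≤s (m≤m+n c (degree t))))
            next≡ = trans (cong (keptBefore keep c +_) (sym (length-infos N P l a t′))) (keptBefore-segment keep m X |X| B₁)
        in cong₂ _++_ A₁ A₂ ,
           restrictInfos-++-segments keep m X Y |X| B₁ C₁ (trans (cong (λ k → infosVec (2 + k) P a (suc l) ts′) next≡) B₂) ,
           rootsAfter-++-segments keep m X Y |X| C₁ C₂
        where
        N = 2 + keptBefore keep c
        P = 2 + keptBefore keep (q ∸ 2)
        t′ = proj₁ (prune keep true c t)
        ts′ = proj₁ (pruneVec keep true (c + degree t) ts)
        X = infos (2 + c) q l a t
        Y = infosVec (2 + c + degree t) q a (suc l) ts
        |X| : length X ≡ degree t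
        |X| = length-infos (2 + c) q l a t

    mutual
      prune-belowDeleted : ∀ c q l a r (t : Tm) → parentKept keep q ≡ false →
        infosL (2 + keptBefore keep c) 1 m (suc r) (proj₂ (prune keep false c t))
          ≡ restrictInfos keep m c r (infos (2 + c) q l a t) ×
        length (proj₂ (prune keep false c t)) + r ≡ rootsAfter keep m c r (infos (2 + c) q l a t)
      prune-belowDeleted c q l a r leaf        kq = refl , refl
      prune-belowDeleted c q l a r (node s ts) kq with keep c in kc
      ... | true rewrite kq =
        let A , B , C = prune-belowKeptVec (suc c) (2 + c) (ar s) 1 (suc r) ts kc ≤-refl
            slots = proj₁ (pruneVec keep true (suc c) ts)
        in trans (cong (λ em → infosL (2 + keptBefore keep c) 1 m (suc r) (node s slots ∷ em)) A)
             (cong (info s 1 (suc r) m ∷_) (trans (++-identityʳ _)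
               (subst (λ k → infosVec (2 + k) (2 + keptBefore keep c) (ar s) 1 slots
                             ≡ restrictInfos keep m (suc c) (suc r) (infosVec (3 + c) (2 + c) (ar s) 1 ts))
                      (keptBefore-kept keep c kc) B))) ,
           trans (cong (λ em → suc (length em + r)) A) (sym C)
      ... | false =
        let B , C = prune-belowDeletedVec (suc c) (2 + c) (ar s) 1 r ts kc
        in subst (λ k → infosL (2 + k) 1 m (suc r) (proj₂ (pruneVec keep false (suc c) ts))
                        ≡ restrictInfos keep m (suc c) r (infosVec (3 + c) (2 + c) (ar s) 1 ts))
                 (keptBefore-deleted keep c kc) B ,
           C

      prune-belowDeletedVec : ∀ {k} c q a l r (ts : Vec Tm k) → parentKept keep q ≡ false →
        infosL (2 + keptBefore keep c) 1 m (suc r) (proj₂ (pruneVec keep false c ts))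
          ≡ restrictInfos keep m c r (infosVec (2 + c) q a l ts) ×
        length (proj₂ (pruneVec keep false c ts)) + r ≡ rootsAfter keep m c r (infosVec (2 + c) q a l ts)
      prune-belowDeletedVec c q a l r []       kq = refl , refl
      prune-belowDeletedVec c q a l r (t ∷ ts) kq =
        let B₁ , C₁ = prune-belowDeleted c q l a r t kq
            B₂ , C₂ = prune-belowDeletedVec (c + degree t) q a (suc l) (length em₁ + r) ts kq
            next≡ = cong (2 +_) (trans (cong (keptBefore keep c +_) (sym (length-infosL N 1 m (suc r) em₁)))
                                       (keptBefore-segment keep m X |X| B₁))
        in trans (infosL-++ N 1 m (suc r) em₁ em₂)
             (restrictInfos-++-segments keep m X Y |X| B₁ (sym C₁)
               (trans (cong₂ (λ k j → infosL k 1 m j em₂) next≡ (+-suc (length em₁) r)) B₂)) ,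
           trans length-++-+
             (sym (rootsAfter-++-segments keep m X Y |X| (sym C₁) (sym C₂)))
        where
        N = 2 + keptBefore keep c
        X = infos (2 + c) q l a t
        Y = infosVec (2 + c + degree t) q a (suc l) ts
        |X| : length X ≡ degree t
        |X| = length-infos (2 + c) q l a t
        em₁ = proj₂ (prune keep false c t)
        em₂ = proj₂ (pruneVec keep false (c + degree t) ts)
        length-++-+ : length (em₁ ++ em₂) + r ≡ length em₂ + (length em₁ + r)
        length-++-+ = trans (cong (_+ r) (trans (length-++ em₁) (+-comm (length em₁) (length em₂))))
                            (+-assoc (length em₂) (length em₁) r)

    rootChildren≡ : ∀ {k} c (ts : Vec Tm k) → rootChildren keep c ts ≡ proj₂ (pruneVec keep false c ts)
    rootChildren≡ c []       = refl
    rootChildren≡ c (t ∷ ts) = cong (proj₂ (prune keep false c t) ++_) (rootChildren≡ (c + degree t) ts)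

    forestInfos-restrict : ∀ {n} (F : Forest S ar n) → keptBefore keep (length (forestInfos F)) ≤ m →
      forestInfos (padTo {S} {ar} m (rootChildren keep 0 F)) ≡ restrictInfos keep m 0 0 (forestInfos F)
    forestInfos-restrict {n} F bound =
      trans (cong (λ L → infosVec 2 1 m 1 (padTo m L)) (rootChildren≡ 0 F))
            (trans (infosVec-padTo 2 1 m 1 m roots |roots|≤m) (proj₁ roots-correct))
      where
      roots = proj₂ (pruneVec keep false 0 F)
      roots-correct = prune-belowDeletedVec 0 1 n 1 0 F refl
      X = forestInfos F
      |roots|≤m : length roots ≤ m
      |roots|≤m = begin
        length roots                                   ≡⟨ +-identityʳ (length roots) ⟨
        length roots + 0                               ≡⟨ proj₂ roots-correct ⟩
        rootsAfter keep m 0 0 X                        ≤⟨ rootsAfter≤ keep m 0 0 X ⟩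
        length (restrictInfos keep m 0 0 X)            ≡⟨ length-restrictInfos keep m 0 0 X ⟩
        keptBefore keep (length X)                     ≤⟨ bound ⟩
        m                                              ∎
        where open ≤-Reasoning

module _ {S : Set} {ar : S → ℕ} where

  private
    Info = NodeInfo {S} {ar}

  ParentsPrecede : ℕ → List Info → Set
  ParentsPrecede c []       = ⊤
  ParentsPrecede c (x ∷ xs) = NodeInfo.pa x ≤ suc c × ParentsPrecede (suc c) xs

  parentsPrecede-++ : ∀ c (X Y : List Info) → ParentsPrecede c X → ParentsPrecede (c + length X) Y → ParentsPrecede c (X ++ Y)
  parentsPrecede-++ c []      Y _          ppY rewrite +-identityʳ c = ppY
  parentsPrecede-++ c (x ∷ X) Y (px , ppX) ppY =
    px , parentsPrecede-++ (suc c) X Y ppX (subst (λ k → ParentsPrecede k Y) (+-suc c (length X)) ppY)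

  mutual
    infos-parentsPrecede : ∀ c q l a (t : Term S ar) → q ≤ suc c → ParentsPrecede c (infos (2 + c) q l a t)
    infos-parentsPrecede c q l a leaf        q≤1+c = tt
    infos-parentsPrecede c q l a (node s ts) q≤1+c = q≤1+c , infosVec-parentsPrecede (suc c) (2 + c) (ar s) 1 ts ≤-refl

    infosVec-parentsPrecede : ∀ {k} c q a l (ts : Vec (Term S ar) k) → q ≤ suc c → ParentsPrecede c (infosVec (2 + c) q a l ts)
    infosVec-parentsPrecede c q a l []       q≤1+c = tt
    infosVec-parentsPrecede c q a l (t ∷ ts) q≤1+c =
      parentsPrecede-++ c (infos (2 + c) q l a t) _ (infos-parentsPrecede c q l a t q≤1+c)
        (subst (λ k → ParentsPrecede k (infosVec (2 + c + degree t) q a (suc l) ts))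
               (cong (c +_) (sym (length-infos (2 + c) q l a t)))
               (infosVec-parentsPrecede (c + degree t) q a (suc l) ts (≤-trans q≤1+c (s≤s (m≤m+n c (degree t))))))

  forestInfos-parentsPrecede : ∀ {n} (F : Forest S ar n) → ParentsPrecede 0 (forestInfos F)
  forestInfos-parentsPrecede {n} F = infosVec-parentsPrecede 0 1 n 1 F (s≤s z≤n)

  ∷-≼ : ∀ {x y : Info} {X Y} → NodeInfo.deco x ≡ NodeInfo.deco y → cncEntry x ℚ.≤ cncEntry y → X ≼ Y → x ∷ X ≼ y ∷ Y
  ∷-≼ dx≡dy ex≤ey (mk≼ ds es) = mk≼ (cong₂ _∷_ dx≡dy ds) (ex≤ey ∷ es)

module _ (keep : ℕ → Bool) where

  keptParent-entry-≤ : ∀ {p₁ p₂ h₁ h₂} → 0ℚ ℚ.≤ h₁ → h₂ ℚ.≤ 1ℚ → parentKept keep p₁ ≡ true → p₁ ≤ p₂ →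
    fromℕ (suc p₁) ℚ.- h₁ ℚ.≤ fromℕ (suc p₂) ℚ.- h₂ →
    fromℕ (3 + keptBefore keep (p₁ ∸ 2)) ℚ.- h₁ ℚ.≤ fromℕ (3 + keptBefore keep (p₂ ∸ 2)) ℚ.- h₂
  keptParent-entry-≤ {p₁} {p₂} 0≤h₁ h₂≤1 k₁ p₁≤p₂ e₁≤e₂ with p₁ <? p₂
  ... | yes p₁<p₂ =
    let 2≤p₁ , kp₁ = parentKept⇒ keep p₁ k₁
    in parent-<⇒entry-≤ 0≤h₁ h₂≤1 (s≤s (s≤s (keptBefore-strict keep kp₁ (∸-monoˡ-< p₁<p₂ 2≤p₁))))
  ... | no p₁≮p₂ with ≤-antisym p₁≤p₂ (≮⇒≥ p₁≮p₂)
  ...   | refl = minus-translate (fromℕ (suc p₁)) (fromℕ (3 + keptBefore keep (p₁ ∸ 2))) e₁≤e₂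

  module _ {S : Set} {ar : S → ℕ} (m : ℕ) (interval : IsIntervalᵇ keep) where

    private
      Info = NodeInfo {S} {ar}
    open HalfPow {S} {ar}

    parentKept-≤ : ∀ {c p₁ p₂} → parentKept keep p₁ ≡ true → p₁ ≤ p₂ → p₂ ≤ suc c → keep c ≡ true →
                   parentKept keep p₂ ≡ true
    parentKept-≤ {c} {p₁} {p₂} k₁ p₁≤p₂ p₂≤1+c kc =
      let 2≤p₁ , kp₁ = parentKept⇒ keep p₁ k₁
      in trans (parentKept-≥2 keep p₂ (≤-trans 2≤p₁ p₁≤p₂))
               (interval (∸-monoˡ-≤ 2 p₁≤p₂) (≤-trans (∸-monoˡ-≤ 2 p₂≤1+c) (m∸n≤m c 1)) kp₁ kc)

    -- The root-child counters satisfy r₂ ≤ r₁: by parentKept-≤, a node whose parent survives in X₁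
    -- also has a surviving parent in X₂, so X₁ never has fewer root children so far.
    restrictInfos-mono : ∀ c {r₁ r₂} (X₁ X₂ : List Info) → ParentsPrecede c X₂ → r₂ ≤ r₁ → X₁ ≼ X₂ →
                         restrictInfos keep m c r₁ X₁ ≼ restrictInfos keep m c r₂ X₂
    restrictInfos-mono c [] [] _ _ _ = mk≼ refl []
    restrictInfos-mono c {r₁} {r₂} (info d₁ p₁ l₁ a₁ ∷ X₁) (info d₂ p₂ l₂ a₂ ∷ X₂) (p₂≤1+c , pp) r₂≤r₁ (mk≼ ds (e₁≤e₂ ∷ es))
      with ∷-injective ds | entry-≤⇒parent-≤ {p₁} {p₂} (halfPow≤1 (a₁ ∸ l₁)) (halfPow>0 (a₂ ∸ l₂)) e₁≤e₂
    ... | refl , ds′ | p₁≤p₂ with keep c in kc | parentKept keep p₁ in k₁ | parentKept keep p₂ in k₂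
    ... | false | _     | _     = restrictInfos-mono (suc c) X₁ X₂ pp r₂≤r₁ (mk≼ ds′ es)
    ... | true  | true  | true  =
      ∷-≼ refl (keptParent-entry-≤ {p₁} {p₂} (halfPow≥0 (a₁ ∸ l₁)) (halfPow≤1 (a₂ ∸ l₂)) k₁ p₁≤p₂ e₁≤e₂)
          (restrictInfos-mono (suc c) X₁ X₂ pp r₂≤r₁ (mk≼ ds′ es))
    ... | true  | true  | false = contradiction (trans (sym (parentKept-≤ k₁ p₁≤p₂ p₂≤1+c kc)) k₂) λ ()
    ... | true  | false | true  =
      ∷-≼ refl (parent-<⇒entry-≤ {1} {2 + keptBefore keep (p₂ ∸ 2)} (halfPow≥0 (m ∸ suc r₁)) (halfPow≤1 (a₂ ∸ l₂)) (s≤s (s≤s z≤n)))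
          (restrictInfos-mono (suc c) X₁ X₂ pp (m≤n⇒m≤1+n r₂≤r₁) (mk≼ ds′ es))
    ... | true  | false | false =
      ∷-≼ refl (minus-antimonoʳ-≤ (fromℕ 2) (halfPow-antimono (∸-monoʳ-≤ m (s≤s r₂≤r₁))))
          (restrictInfos-mono (suc c) X₁ X₂ pp (s≤s r₂≤r₁) (mk≼ ds′ es))

lookupℕ : ∀ {n} → Subset n → ℕ → Bool
lookupℕ []      c       = false
lookupℕ (x ∷ I) zero    = x
lookupℕ (x ∷ I) (suc c) = lookupℕ I c

lookup-fromℕ< : ∀ {n} (I : Subset n) c (c<n : c < n) → lookup I (fromℕ< c<n) ≡ lookupℕ I c
lookup-fromℕ< (x ∷ I) zero    _         = refl
lookup-fromℕ< (x ∷ I) (suc c) (s≤s c<n) = lookup-fromℕ< I c c<n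

lookupℕ-≥ : ∀ {n} (I : Subset n) c → n ≤ c → lookupℕ I c ≡ false
lookupℕ-≥ []      c       _         = refl
lookupℕ-≥ (x ∷ I) (suc c) (s≤s n≤c) = lookupℕ-≥ I c n≤c

lookupℕ⇒< : ∀ {n} (I : Subset n) c → lookupℕ I c ≡ true → c < n
lookupℕ⇒< (x ∷ I) zero    _  = s≤s z≤n
lookupℕ⇒< (x ∷ I) (suc c) eq = s≤s (lookupℕ⇒< I c eq)

keepIdx≗lookupℕ : ∀ {S : Set} {ar : S → ℕ} {n} (I : Subset n) c → keepIdx {S} {ar} I c ≡ lookupℕ I c
keepIdx≗lookupℕ {n = n} I c with c <? n
... | no c≮n = sym (lookupℕ-≥ I c (≮⇒≥ c≮n))
... | yes c<n with lookup I (fromℕ< c<n) in eq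
...   | true  = trans (sym eq) (lookup-fromℕ< I c c<n)
...   | false = trans (sym eq) (lookup-fromℕ< I c c<n)

keptBefore-cong : ∀ {f g : ℕ → Bool} → (∀ c → f c ≡ g c) → ∀ k → keptBefore f k ≡ keptBefore g k
keptBefore-cong f≗g zero = refl
keptBefore-cong f≗g (suc k) rewrite f≗g k | keptBefore-cong f≗g k = refl

keptBefore-lookupℕ-∷ : ∀ {n} x (I : Subset n) k →
  keptBefore (lookupℕ (x ∷ I)) (suc k) ≡ (if x then suc else id) (keptBefore (lookupℕ I) k)
keptBefore-lookupℕ-∷ true  I zero    = refl
keptBefore-lookupℕ-∷ false I zero    = refl
keptBefore-lookupℕ-∷ true  I (suc k) with lookupℕ I k
... | true  = cong suc (keptBefore-lookupℕ-∷ true I k)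
... | false = keptBefore-lookupℕ-∷ true I k
keptBefore-lookupℕ-∷ false I (suc k) with lookupℕ I k
... | true  = cong suc (keptBefore-lookupℕ-∷ false I k)
... | false = keptBefore-lookupℕ-∷ false I k

keptBefore-lookupℕ≤ : ∀ {n} (I : Subset n) k → keptBefore (lookupℕ I) k ≤ ∣ I ∣
keptBefore-lookupℕ≤ []      zero    = z≤n
keptBefore-lookupℕ≤ []      (suc k) = keptBefore-lookupℕ≤ [] k
keptBefore-lookupℕ≤ (x ∷ I) zero    = z≤n
keptBefore-lookupℕ≤ (true  ∷ I) (suc k) rewrite keptBefore-lookupℕ-∷ true  I k = s≤s (keptBefore-lookupℕ≤ I k)
keptBefore-lookupℕ≤ (false ∷ I) (suc k) rewrite keptBefore-lookupℕ-∷ false I k = keptBefore-lookupℕ≤ I k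

module _ {S : Set} {ar : S → ℕ} where

  keptBefore-keepIdx≤ : ∀ {n} (I : Subset n) k → keptBefore (keepIdx {S} {ar} I) k ≤ ∣ I ∣
  keptBefore-keepIdx≤ I k =
    ≤-trans (≤-reflexive (keptBefore-cong (keepIdx≗lookupℕ {S} {ar} I) k)) (keptBefore-lookupℕ≤ I k)

  keepIdx-interval : ∀ {n} (I : Subset n) → IsInterval I → IsIntervalᵇ (keepIdx {S} {ar} I)
  keepIdx-interval I I-interval {i} {j} {k} i≤j j≤k ki kk =
    trans (keepIdx≗lookupℕ {S} {ar} I j) (trans (sym (lookup-fromℕ< I j j<n)) ([]=⇒lookup j∈I))
    where
    toLookupℕ : ∀ {c} → keepIdx {S} {ar} I c ≡ true → lookupℕ I c ≡ true
    toLookupℕ {c} eq = trans (sym (keepIdx≗lookupℕ {S} {ar} I c)) eq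
    i<n = lookupℕ⇒< I i (toLookupℕ ki)
    k<n = lookupℕ⇒< I k (toLookupℕ kk)
    j<n = ≤-<-trans j≤k k<n
    member : ∀ {c} (c<n : c < _) → keepIdx {S} {ar} I c ≡ true → fromℕ< c<n ∈ I
    member {c} c<n eq = lookup⇒[]= (fromℕ< c<n) I (trans (lookup-fromℕ< I c c<n) (toLookupℕ eq))
    j∈I = I-interval {fromℕ< i<n} {fromℕ< j<n} {fromℕ< k<n}
            (subst₂ _≤_ (sym (toℕ-fromℕ< i<n)) (sym (toℕ-fromℕ< j<n)) i≤j)
            (subst₂ _≤_ (sym (toℕ-fromℕ< j<n)) (sym (toℕ-fromℕ< k<n)) j≤k)
            (member i<n ki) (member k<n kk)

module _ {S : Set} {ar : S → ℕ} where

  emb : NodeInfo {S} {ar} → NodeInfo {SN S ar} {arN S ar}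
  emb (info s p l a) = info (inj₁ s) p l a

  mutual
    degree-embed : ∀ (t : Term S ar) → degree (embed t) ≡ degree t
    degree-embed leaf        = refl
    degree-embed (node s ts) = cong suc (degreeVec-embedVec ts)

    degreeVec-embedVec : ∀ {k} (ts : Vec (Term S ar) k) → degreeVec (embedVec ts) ≡ degreeVec ts
    degreeVec-embedVec []       = refl
    degreeVec-embedVec (t ∷ ts) = cong₂ _+_ (degree-embed t) (degreeVec-embedVec ts)

  mutual
    infos-embed : ∀ next p l a (t : Term S ar) → infos next p l a (embed t) ≡ List.map emb (infos next p l a t)
    infos-embed next p l a leaf        = refl
    infos-embed next p l a (node s ts) = cong (info (inj₁ s) p l a ∷_) (infosVec-embedVec (suc next) next (ar s) 1 ts)

    infosVec-embedVec : ∀ {k} next p a l (ts : Vec (Term S ar) k) →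
                        infosVec next p a l (embedVec ts) ≡ List.map emb (infosVec next p a l ts)
    infosVec-embedVec next p a l []       = refl
    infosVec-embedVec next p a l (t ∷ ts) =
      trans (cong₂ _++_ (infos-embed next p l a t)
                        (trans (cong (λ k → infosVec (next + k) p a (suc l) (embedVec ts)) (degree-embed t))
                               (infosVec-embedVec (next + degree t) p a (suc l) ts)))
            (sym (map-++ emb (infos next p l a t) _))

  restrictInfos-map-emb : ∀ keep m c r X →
    restrictInfos keep m c r (List.map emb X) ≡ List.map emb (restrictInfos keep m c r X)
  restrictInfos-map-emb keep m c r [] = refl
  restrictInfos-map-emb keep m c r (info d p l a ∷ X) with keep c | parentKept keep p
  ... | false | _     = restrictInfos-map-emb keep m (suc c) r X
  ... | true  | true  = cong (_ ∷_) (restrictInfos-map-emb keep m (suc c) r X)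
  ... | true  | false = cong (_ ∷_) (restrictInfos-map-emb keep m (suc c) (suc r) X)

  nodeInfos-restrictF : ∀ {n} (F : Forest S ar n) (I : Subset n) → IsInterval I →
    nodeInfos (toTerm (restrictF F I))
      ≡ info (inj₂ ∣ I ∣) 1 0 ∣ I ∣ ∷ restrictInfos (keepIdx {S} {ar} I) ∣ I ∣ 0 0 (forestInfos (embedVec F))
  nodeInfos-restrictF {n} F I I-interval = cong (info (inj₂ m) 1 0 m ∷_) (begin
    forestInfos (embedVec (restrictF F I))             ≡⟨ infosVec-embedVec 2 1 m 1 (restrictF F I) ⟩
    List.map emb (forestInfos (restrictF F I))         ≡⟨ cong (List.map emb) (forestInfos-restrict keep m keep-interval F bound) ⟩
    List.map emb (restrictInfos keep m 0 0 X)          ≡⟨ restrictInfos-map-emb keep m 0 0 X ⟨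
    restrictInfos keep m 0 0 (List.map emb X)          ≡⟨ cong (restrictInfos keep m 0 0) (infosVec-embedVec 2 1 n 1 F) ⟨
    restrictInfos keep m 0 0 (forestInfos (embedVec F)) ∎)
    where
    open ≡-Reasoning
    m = ∣ I ∣
    keep = keepIdx {S} {ar} I
    keep-interval = keepIdx-interval {S} {ar} I I-interval
    X = forestInfos F
    bound = keptBefore-keepIdx≤ {S} {ar} I (length X)

lemma4p3p2 : (S : Set) (ar : S → ℕ) (n : ℕ) (F₁ F₂ : Forest S ar n) →
    Leaning F₁ → Leaning F₂ → F₁ ⪯F F₂ →
    (I : Subset n) → IsInterval I →
    restrictF F₁ I ⪯F restrictF F₂ I
lemma4p3p2 S ar n F₁ F₂ _ _ F₁⪯F₂ I I-interval =
  ≼⇒⪯ {t₁ = toTerm (restrictF F₁ I)} {toTerm (restrictF F₂ I)}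
    (subst₂ _≼_ (sym (nodeInfos-restrictF F₁ I I-interval)) (sym (nodeInfos-restrictF F₂ I I-interval))
      (∷-≼ refl ℚ.≤-refl (restrictInfos-mono keep ∣ I ∣ keep-interval 0 X₁ X₂ X₂-parentsPrecede z≤n X₁≼X₂)))
  where
  keep = keepIdx {S} {ar} I
  keep-interval = keepIdx-interval {S} {ar} I I-interval
  X₁ = forestInfos (embedVec F₁)
  X₂ = forestInfos (embedVec F₂)
  X₂-parentsPrecede = forestInfos-parentsPrecede (embedVec F₂)
  X₁≼X₂ : X₁ ≼ X₂
  X₁≼X₂ = ∷-≼⁻ (⪯⇒≼ {t₁ = toTerm F₁} {toTerm F₂} F₁⪯F₂)
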